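{- Let $G$ be a finite simple graph. Then: (a) for any two maximum matchings $F,F'$ of $G$, $\nu(G\backslash F')\leq 2\nu(G\backslash F)$; (b) $L(G)\leq 2l(G)$; (c) if $L(G)=2l(G)$, $F_L,F_l$ are maximum matchings of $G$ with $\nu(G\backslash F_L)=L(G)$ and $\nu(G\backslash F_l)=l(G)$, and $H_L$ is any maximum matching of the graph $G\backslash F_L$, then: (c1) $F_l\backslash F_L\subset H_L$; (c2) $H_L\backslash F_l$ is a maximum matching of $G\backslash F_l$; (c3) $F_L\backslash F_l$ is a maximum matching of $G\backslash F_l$; (d) if $G$ contains a perfect matching, then $L(G)\leq \frac{3}{2}l(G)$.
   Context: All graphs are finite, undirected, without loops or multiple edges. A matching is a set of pairwise non-adjacent edges; $\nu(G)$ is the maximum cardinality of a matching of $G$, and a matching is maximum if it has $\nu(G)$ edges. For $E'\subseteq E(G)$, $G\backslash E'$ is the graph obtained from $G$ by deleting the edges in $E'$ (keeping all vertices). Define $L(G)=\max\{\nu(G\backslash F): F \text{ a maximum matching of } G\}$ and $l(G)=\min\{\nu(G\backslash F): F \text{ a maximum matching of } G\}$. -}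

module Defs where

open import Data.Nat using (ℕ; zero; suc; _+_; _≤_; _<ᵇ_)
open import Data.Fin using (Fin; toℕ)
open import Data.Bool using (Bool; true; false; _∧_; not; if_then_else_)
open import Data.List using (List; map)
open import Data.Nat.ListAction using (sum)
open import Data.List.Base using (allFin)
open import Data.Product using (Σ; _×_; ∃)
open import Relation.Binary.PropositionalEquality using (_≡_)

-- A (binary) relation on the vertex set Fin n; an edge set is a symmetric one,
-- {i , j} being an edge iff E i j ≡ true.
EdgeSet : ℕ → Set
EdgeSet n = Fin n → Fin n → Bool

record Graph (n : ℕ) : Set where
  field
    adj      : EdgeSet n
    adj-sym  : ∀ i j → adj i j ≡ adj j i
    adj-irr  : ∀ i → adj i i ≡ false
open Graph public

_∖ₑ_ : ∀ {n} → EdgeSet n → EdgeSet n → EdgeSet n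
(A ∖ₑ B) i j = A i j ∧ not (B i j)

_⊆ₑ_ : ∀ {n} → EdgeSet n → EdgeSet n → Set
A ⊆ₑ B = ∀ i j → A i j ≡ true → B i j ≡ true

-- The edge {i,j} is
-- removed if it lies in F (tested in both orientations, so that the result is
-- symmetric for any F; for symmetric F this is exactly adj G ∖ₑ F).
_∖_ : ∀ {n} → Graph n → EdgeSet n → Graph n
_∖_ {n} G F = record { adj = a ; adj-sym = s ; adj-irr = r }
  where
  a : EdgeSet n
  a i j = adj G i j ∧ not (F i j) ∧ not (F j i)
  open import Relation.Binary.PropositionalEquality using (cong₂; refl; trans)
  open import Data.Bool.Properties using (∧-comm; ∧-assoc)
  s : ∀ i j → a i j ≡ a j i
  s i j rewrite adj-sym G i j | ∧-comm (not (F i j)) (not (F j i)) = refl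
  r : ∀ i → a i i ≡ false
  r i rewrite adj-irr G i = refl

size : ∀ {n} → EdgeSet n → ℕ
size {n} E = sum (map (λ i → sum (map (λ j → if (toℕ i <ᵇ toℕ j) ∧ E i j then 1 else 0) (allFin n))) (allFin n))

record IsMatching {n : ℕ} (G : Graph n) (M : EdgeSet n) : Set where
  field
    m-sym    : ∀ i j → M i j ≡ M j i
    m-sub    : M ⊆ₑ adj G
    m-unique : ∀ i j k → M i j ≡ true → M i k ≡ true → j ≡ k

IsMaximumMatching : ∀ {n} → Graph n → EdgeSet n → Set
IsMaximumMatching G M = IsMatching G M × (∀ M' → IsMatching G M' → size M' ≤ size M)

IsNu : ∀ {n} → Graph n → ℕ → Set
IsNu G k = Σ _ λ M → IsMaximumMatching G M × size M ≡ k

IsL : ∀ {n} → Graph n → ℕ → Set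
IsL G k = (Σ _ λ F → IsMaximumMatching G F × IsNu (G ∖ F) k)
        × (∀ F m → IsMaximumMatching G F → IsNu (G ∖ F) m → m ≤ k)

Isl : ∀ {n} → Graph n → ℕ → Set
Isl G k = (Σ _ λ F → IsMaximumMatching G F × IsNu (G ∖ F) k)
        × (∀ F m → IsMaximumMatching G F → IsNu (G ∖ F) m → k ≤ m)

IsPerfectMatching : ∀ {n} → Graph n → EdgeSet n → Set
IsPerfectMatching G M = IsMatching G M × (∀ i → ∃ λ j → M i j ≡ true)

-- A maximum matching H of G \ F' lies in (H \ F) ∪ (F \ F'); both H \ F and F' \ F are
-- matchings of G \ F, and |F \ F'| = |F' \ F| for maximum F and F', whence (a) and (b).
-- When L = 2l every inequality of this chain is tight, and the tight inclusion
-- H_L ∩ F_l ⊆ F_l \ F_L of finite edge sets is an equality; this gives (c).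
-- For (d), every maximum matching is perfect, so both ends of an edge of H_L ∩ F_l are
-- covered by C = F_L \ F_l.  With B = H_L \ F_l and D = C plus the edges of B avoiding
-- the vertices covered by C, the weight w = deg_B + deg_C + deg_D satisfies w u + w v ≥ 4
-- on every edge uv of H_L.  Summing over the matching H_L gives
-- 4L ≤ Σ w = 2(|B| + |C| + |D|) ≤ 6l, since B, C and D are matchings of G \ F_l.
module Submission where

open import Defs
open import Data.Nat using (ℕ; zero; suc; _+_; _*_; _≤_; _<_; _<ᵇ_; z≤n)
open import Data.Nat.Properties
open import Data.Nat.Tactic.RingSolver using (solve-∀)
import Data.Nat.ListAction as List
open import Algebra.Properties.Semiring.Sum +-*-semiring
  using (sum; sum-syntax; sum-cong-≗; sum-replicate-zero; ∑-distrib-+; ∑-comm; *-distribʳ-sum)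
open import Data.Fin using (Fin; toℕ; zero; suc)
open import Data.Fin.Properties using (toℕ-injective; any?) renaming (suc-injective to Fin-suc-injective)
open import Data.Bool using (Bool; true; false; _∧_; _∨_; not; if_then_else_; T)
open import Data.Bool.Properties using (∧-comm; ∧-zeroʳ; ∨-zeroʳ) renaming (_≟_ to _≟ᵇ_)
open import Data.List using (map; tabulate)
open import Data.List.Base using (allFin)
open import Data.List.Properties using (map-tabulate)
open import Data.Product using (_×_; ∃; _,_; proj₁; proj₂)
open import Data.Sum using (_⊎_; inj₁; inj₂)
open import Data.Unit using (tt)
open import Function using (_∘_; id)
open import Relation.Binary using (tri<; tri≈; tri>)
open import Relation.Binary.PropositionalEquality
open import Relation.Nullary using (¬_; does; yes; no; contradiction)

private
  variable
    n k l : ℕ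
    i j u v w : Fin n
    a b : Bool
    E M N X Y F F' H K : EdgeSet n

sum-mono-≤ : {f g : Fin n → ℕ} → (∀ i → f i ≤ g i) → sum f ≤ sum g
sum-mono-≤ {zero}  f≤g = z≤n
sum-mono-≤ {suc n} f≤g = +-mono-≤ (f≤g zero) (sum-mono-≤ (f≤g ∘ suc))

sum-mono-< : {f g : Fin n → ℕ} → (∀ i → f i ≤ g i) → ∀ i → f i < g i → sum f < sum g
sum-mono-< {suc n} f≤g zero    f0<g0 = +-mono-<-≤ f0<g0 (sum-mono-≤ (f≤g ∘ suc))
sum-mono-< {suc n} f≤g (suc i) fi<gi = +-mono-≤-< (f≤g zero) (sum-mono-< (f≤g ∘ suc) i fi<gi)

sum-≥⇒≗ : {f g : Fin n → ℕ} → (∀ i → f i ≤ g i) → sum g ≤ sum f → ∀ i → f i ≡ g i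
sum-≥⇒≗ f≤g ∑g≤∑f i with m≤n⇒m<n∨m≡n (f≤g i)
... | inj₁ fi<gi = contradiction ∑g≤∑f (<⇒≱ (sum-mono-< f≤g i fi<gi))
... | inj₂ fi≡gi = fi≡gi

≤-sum : (f : Fin n → ℕ) (i : Fin n) → f i ≤ sum f
≤-sum f zero    = m≤m+n _ _
≤-sum f (suc i) = ≤-trans (≤-sum (f ∘ suc) i) (m≤n+m _ _)

sum-allFin : (f : Fin n → ℕ) → List.sum (map f (allFin n)) ≡ sum f
sum-allFin f = trans (cong List.sum (map-tabulate id f)) (sum-tabulate f)
  where
  sum-tabulate : ∀ {n} (f : Fin n → ℕ) → List.sum (tabulate f) ≡ sum f
  sum-tabulate {zero}  f = refl
  sum-tabulate {suc n} f = cong (f zero +_) (sum-tabulate (f ∘ suc))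

ind : Bool → ℕ
ind b = if b then 1 else 0

ind-injective : ind a ≡ ind b → a ≡ b
ind-injective {true}  {true}  _ = refl
ind-injective {false} {false} _ = refl

sum-ind-unique : (P : Fin n → Bool) → (∀ i j → P i ≡ true → P j ≡ true → i ≡ j) →
                 sum (ind ∘ P) ≤ 1
sum-ind-unique {zero}  P unique = z≤n
sum-ind-unique {suc n} P unique with P zero in P0
... | true  = ≤-reflexive (cong suc (trans (sum-cong-≗ rest-false) (sum-replicate-zero n)))
  where
  rest-false : ∀ i → ind (P (suc i)) ≡ 0
  rest-false i with P (suc i) in Pi
  ... | false = refl
  ... | true with () ← unique zero (suc i) P0 Pi
... | false = sum-ind-unique (P ∘ suc) (λ i j Pi Pj → Fin-suc-injective (unique _ _ Pi Pj))

∧-true : a ∧ b ≡ true → a ≡ true × b ≡ true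
∧-true {true} {true} _ = refl , refl

not-true : not a ≡ true → a ≡ false
not-true {false} _ = refl

upper : EdgeSet n → Fin n → Fin n → ℕ
upper E i j = ind ((toℕ i <ᵇ toℕ j) ∧ E i j)

size≡∑∑upper : (E : EdgeSet n) → size E ≡ ∑[ i < n ] ∑[ j < n ] upper E i j
size≡∑∑upper {n} E =
  trans (sum-allFin λ i → List.sum (map (upper E i) (allFin n)))
        (sum-cong-≗ λ i → sum-allFin (upper E i))

upper-< : toℕ i < toℕ j → upper E i j ≡ ind (E i j)
upper-< {i = i} {j} i<j with toℕ i <ᵇ toℕ j | <⇒<ᵇ i<j
... | true | _ = refl

upper-> : toℕ j < toℕ i → upper E i j ≡ 0
upper-> {j = j} {i} j<i with toℕ i <ᵇ toℕ j in i<ᵇj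
... | false = refl
... | true  = contradiction (<ᵇ⇒< _ _ (subst T (sym i<ᵇj) tt)) (<⇒≯ j<i)

upper-≤ : (X Y Z : EdgeSet n) → (∀ i j → ind (X i j) ≤ ind (Y i j) + ind (Z i j)) →
          ∀ i j → upper X i j ≤ upper Y i j + upper Z i j
upper-≤ X Y Z le i j with toℕ i <ᵇ toℕ j
... | true  = le i j
... | false = z≤n

upper-≡ : (X Y Z : EdgeSet n) → (∀ i j → ind (X i j) ≡ ind (Y i j) + ind (Z i j)) →
          ∀ i j → upper X i j ≡ upper Y i j + upper Z i j
upper-≡ X Y Z eq i j with toℕ i <ᵇ toℕ j
... | true  = eq i j
... | false = refl

upper-mono : X ⊆ₑ Y → ∀ i j → upper X i j ≤ upper Y i j
upper-mono {X = X} {Y = Y} X⊆Y i j with toℕ i <ᵇ toℕ j | X i j in Xij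
... | false | _     = z≤n
... | true  | false = z≤n
... | true  | true  = ≤-reflexive (cong ind (sym (X⊆Y i j Xij)))

size-+ : (Y Z : EdgeSet n) →
         size Y + size Z ≡ ∑[ i < n ] ∑[ j < n ] (upper Y i j + upper Z i j)
size-+ {n} Y Z = begin
  size Y + size Z
    ≡⟨ cong₂ _+_ (size≡∑∑upper Y) (size≡∑∑upper Z) ⟩
  ∑[ i < n ] ∑[ j < n ] upper Y i j + ∑[ i < n ] ∑[ j < n ] upper Z i j
    ≡⟨ ∑-distrib-+ (λ i → ∑[ j < n ] upper Y i j) (λ i → ∑[ j < n ] upper Z i j) ⟨
  ∑[ i < n ] (∑[ j < n ] upper Y i j + ∑[ j < n ] upper Z i j)
    ≡⟨ sum-cong-≗ (λ i → ∑-distrib-+ (upper Y i) (upper Z i)) ⟨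
  ∑[ i < n ] ∑[ j < n ] (upper Y i j + upper Z i j) ∎
  where open ≡-Reasoning

size-≤-+ : (X Y Z : EdgeSet n) → (∀ i j → ind (X i j) ≤ ind (Y i j) + ind (Z i j)) →
           size X ≤ size Y + size Z
size-≤-+ X Y Z le = begin
  size X
    ≡⟨ size≡∑∑upper X ⟩
  ∑[ i < _ ] ∑[ j < _ ] upper X i j
    ≤⟨ sum-mono-≤ (λ i → sum-mono-≤ (upper-≤ X Y Z le i)) ⟩
  ∑[ i < _ ] ∑[ j < _ ] (upper Y i j + upper Z i j)
    ≡⟨ size-+ Y Z ⟨
  size Y + size Z ∎
  where open ≤-Reasoning

size-≡-+ : (X Y Z : EdgeSet n) → (∀ i j → ind (X i j) ≡ ind (Y i j) + ind (Z i j)) →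
           size X ≡ size Y + size Z
size-≡-+ X Y Z eq = begin
  size X
    ≡⟨ size≡∑∑upper X ⟩
  ∑[ i < _ ] ∑[ j < _ ] upper X i j
    ≡⟨ sum-cong-≗ (λ i → sum-cong-≗ (upper-≡ X Y Z eq i)) ⟩
  ∑[ i < _ ] ∑[ j < _ ] (upper Y i j + upper Z i j)
    ≡⟨ size-+ Y Z ⟨
  size Y + size Z ∎
  where open ≡-Reasoning

size-mono : X ⊆ₑ Y → size X ≤ size Y
size-mono {X = X} {Y} X⊆Y = begin
  size X                            ≡⟨ size≡∑∑upper X ⟩
  ∑[ i < _ ] ∑[ j < _ ] upper X i j  ≤⟨ sum-mono-≤ (λ i → sum-mono-≤ (upper-mono X⊆Y i)) ⟩
  ∑[ i < _ ] ∑[ j < _ ] upper Y i j  ≡⟨ size≡∑∑upper Y ⟨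
  size Y                            ∎
  where open ≤-Reasoning

_∩ₑ_ : EdgeSet n → EdgeSet n → EdgeSet n
(X ∩ₑ Y) i j = X i j ∧ Y i j

size-split : (X Y : EdgeSet n) → size X ≡ size (X ∖ₑ Y) + size (X ∩ₑ Y)
size-split X Y = size-≡-+ X (X ∖ₑ Y) (X ∩ₑ Y) split
  where
  split : ∀ i j → ind (X i j) ≡ ind (X i j ∧ not (Y i j)) + ind (X i j ∧ Y i j)
  split i j with X i j | Y i j
  ... | true  | true  = refl
  ... | true  | false = refl
  ... | false | _     = refl

size-∩ₑ-comm : (X Y : EdgeSet n) → size (X ∩ₑ Y) ≡ size (Y ∩ₑ X)
size-∩ₑ-comm X Y = ≤-antisym (size-mono (swap X Y)) (size-mono (swap Y X))
  where
  swap : (X Y : EdgeSet _) → (X ∩ₑ Y) ⊆ₑ (Y ∩ₑ X)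
  swap X Y i j = trans (∧-comm (Y i j) (X i j))

-- H ⊆ (H \ F) ∪ (F \ F') as soon as H and F' share no edge.
size-≤-∖ₑ+∖ₑ : (H F F' : EdgeSet n) → (∀ i j → H i j ≡ true → F' i j ≡ false) →
               size H ≤ size (H ∖ₑ F) + size (F ∖ₑ F')
size-≤-∖ₑ+∖ₑ H F F' disjoint = size-≤-+ H (H ∖ₑ F) (F ∖ₑ F') cover
  where
  cover : ∀ i j → ind (H i j) ≤ ind (H i j ∧ not (F i j)) + ind (F i j ∧ not (F' i j))
  cover i j with H i j in Hij
  ... | false = z≤n
  ... | true rewrite disjoint i j Hij with F i j
  ...   | true  = ≤-refl
  ...   | false = ≤-refl

upper⊇⇒⊇ : (∀ i j → X i j ≡ X j i) → (∀ i j → Y i j ≡ Y j i) → (∀ i → Y i i ≡ false) →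
           (∀ i j → toℕ i < toℕ j → Y i j ≡ true → X i j ≡ true) → Y ⊆ₑ X
upper⊇⇒⊇ X-sym Y-sym Y-irr upward i j Yij with <-cmp (toℕ i) (toℕ j)
... | tri< i<j _ _ = upward i j i<j Yij
... | tri> _ _ j<i = trans (X-sym i j) (upward j i j<i (trans (Y-sym j i) Yij))
... | tri≈ _ i≡j _ with toℕ-injective i≡j
...   | refl with () ← trans (sym Yij) (Y-irr i)

⊆-size-≥⇒upper⊇ : X ⊆ₑ Y → size Y ≤ size X →
                  ∀ i j → toℕ i < toℕ j → Y i j ≡ true → X i j ≡ true
⊆-size-≥⇒upper⊇ {X = X} {Y = Y} X⊆Y |Y|≤|X| i j i<j Yij = ind-injective (begin
  ind (X i j)   ≡⟨ upper-< {E = X} i<j ⟨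
  upper X i j   ≡⟨ sum-≥⇒≗ (upper-mono X⊆Y i) (≤-reflexive (sym (rows i))) j ⟩
  upper Y i j   ≡⟨ upper-< {E = Y} i<j ⟩
  ind (Y i j)   ≡⟨ cong ind Yij ⟩
  1             ∎)
  where
  open ≡-Reasoning
  rows : ∀ i → ∑[ j < _ ] upper X i j ≡ ∑[ j < _ ] upper Y i j
  rows = sum-≥⇒≗ (λ i → sum-mono-≤ (upper-mono X⊆Y i))
           (subst₂ _≤_ (size≡∑∑upper Y) (size≡∑∑upper X) |Y|≤|X|)

degree : EdgeSet n → Fin n → ℕ
degree {n} E i = ∑[ j < n ] ind (E i j)

sum-degree : (∀ i j → E i j ≡ E j i) → (∀ i → E i i ≡ false) →
             ∑[ i < n ] degree E i ≡ 2 * size E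
sum-degree {n = n} {E = E} E-sym E-irr = begin
  ∑[ i < n ] ∑[ j < n ] ind (E i j)
    ≡⟨ sum-cong-≗ (λ i → sum-cong-≗ (both-orientations i)) ⟩
  ∑[ i < n ] ∑[ j < n ] (upper E i j + upper E j i)
    ≡⟨ sum-cong-≗ (λ i → ∑-distrib-+ (upper E i) (λ j → upper E j i)) ⟩
  ∑[ i < n ] (∑[ j < n ] upper E i j + ∑[ j < n ] upper E j i)
    ≡⟨ ∑-distrib-+ (λ i → ∑[ j < n ] upper E i j) (λ i → ∑[ j < n ] upper E j i) ⟩
  ∑[ i < n ] ∑[ j < n ] upper E i j + ∑[ i < n ] ∑[ j < n ] upper E j i
    ≡⟨ cong (∑[ i < n ] ∑[ j < n ] upper E i j +_) (∑-comm (λ i j → upper E j i)) ⟩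
  ∑[ i < n ] ∑[ j < n ] upper E i j + ∑[ j < n ] ∑[ i < n ] upper E j i
    ≡⟨ cong₂ _+_ (size≡∑∑upper E) (size≡∑∑upper E) ⟨
  size E + size E
    ≡⟨ cong (size E +_) (+-identityʳ (size E)) ⟨
  2 * size E ∎
  where
  open ≡-Reasoning
  both-orientations : ∀ i j → ind (E i j) ≡ upper E i j + upper E j i
  both-orientations i j with <-cmp (toℕ i) (toℕ j)
  ... | tri< i<j _ _ rewrite upper-< {E = E} i<j | upper-> {E = E} i<j = sym (+-identityʳ _)
  ... | tri> _ _ j<i rewrite upper-> {E = E} j<i | upper-< {E = E} j<i = cong ind (E-sym i j)
  ... | tri≈ _ i≡j _ with toℕ-injective i≡j
  ...   | refl rewrite E-irr i | ∧-zeroʳ (toℕ i <ᵇ toℕ i) = refl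

≤-degree : (E : EdgeSet n) → E i j ≡ true → 1 ≤ degree E i
≤-degree {i = i} {j = j} E Eij = subst (_≤ degree E i) (cong ind Eij) (≤-sum (ind ∘ E i) j)

degree-uncovered : (E : EdgeSet n) → ¬ (∃ λ j → E i j ≡ true) → degree E i ≡ 0
degree-uncovered {n = n} {i = i} E uncovered =
  trans (sum-cong-≗ no-edge) (sum-replicate-zero n)
  where
  no-edge : ∀ j → ind (E i j) ≡ 0
  no-edge j with E i j in Eij
  ... | false = refl
  ... | true  = contradiction (j , Eij) uncovered

covered : EdgeSet n → Fin n → Bool
covered E i = does (any? λ j → E i j ≟ᵇ true)

covered-intro : E i j ≡ true → covered E i ≡ true
covered-intro {E = E} {i = i} {j = j} Eij with any? (λ j → E i j ≟ᵇ true)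
... | yes _         = refl
... | no uncovered = contradiction (j , Eij) uncovered

covered-elim : covered E i ≡ true → ∃ λ j → E i j ≡ true
covered-elim {E = E} {i = i} _ with any? (λ j → E i j ≟ᵇ true)
... | yes edge = edge

greedyUnion : EdgeSet n → EdgeSet n → EdgeSet n
greedyUnion M N i j = M i j ∨ (N i j ∧ not (covered M i) ∧ not (covered M j))

greedyUnion-⊇ˡ : M i j ≡ true → greedyUnion M N i j ≡ true
greedyUnion-⊇ˡ Mij rewrite Mij = refl

greedyUnion-⊇ʳ : N i j ≡ true → covered M i ≡ false → covered M j ≡ false →
                 greedyUnion M N i j ≡ true
greedyUnion-⊇ʳ Nij Mi Mj rewrite Nij | Mi | Mj = ∨-zeroʳ _

greedyUnion-edge : greedyUnion M N i j ≡ true →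
                   M i j ≡ true ⊎ (N i j ≡ true × covered M i ≡ false × covered M j ≡ false)
greedyUnion-edge {M = M} {i = i} {j = j} edge with M i j
... | true  = inj₁ refl
... | false with ∧-true edge
...   | Nij , uncovered with ∧-true uncovered
...     | Mi , Mj = inj₂ (Nij , not-true Mi , not-true Mj)

module _ {G : Graph n} where
  open IsMatching

  matching-irreflexive : IsMatching G M → ∀ i → M i i ≡ false
  matching-irreflexive {M = M} M-matching i with M i i in Mii
  ... | false = refl
  ... | true  with () ← trans (sym (m-sub M-matching i i Mii)) (adj-irr G i)

  degree-≤1 : IsMatching G M → ∀ i → degree M i ≤ 1
  degree-≤1 {M = M} M-matching i = sum-ind-unique (M i) (m-unique M-matching i)

  sum-degree-matching : IsMatching G M → ∑[ i < n ] degree M i ≡ 2 * size M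
  sum-degree-matching M-matching =
    sum-degree (m-sym M-matching) (matching-irreflexive M-matching)

  edge-∖ : adj (G ∖ K) i j ≡ true → adj G i j ≡ true × K i j ≡ false × K j i ≡ false
  edge-∖ edge with ∧-true edge
  ... | in-G , rest with ∧-true rest
  ...   | Kij , Kji = in-G , not-true Kij , not-true Kji

  matching-∖-⊆ : IsMatching (G ∖ K) H → H ⊆ₑ adj G
  matching-∖-⊆ {K = K} H-matching i j Hij = proj₁ (edge-∖ {K = K} (m-sub H-matching i j Hij))

  matching-∖-disjoint : IsMatching (G ∖ K) H → ∀ i j → H i j ≡ true → K i j ≡ false
  matching-∖-disjoint {K = K} H-matching i j Hij =
    proj₁ (proj₂ (edge-∖ {K = K} (m-sub H-matching i j Hij)))

  ∖ₑ-matching : {G' : Graph n} → (∀ i j → K i j ≡ K j i) →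
                IsMatching G' X → X ⊆ₑ adj G → IsMatching (G ∖ K) (X ∖ₑ K)
  m-sym    (∖ₑ-matching {K = K} K-sym X-matching X⊆G) i j
    rewrite m-sym X-matching i j | K-sym i j = refl
  m-sub    (∖ₑ-matching {K = K} K-sym X-matching X⊆G) i j edge with ∧-true edge
  ... | Xij , notKij rewrite X⊆G i j Xij | not-true notKij | sym (K-sym i j) | not-true notKij = refl
  m-unique (∖ₑ-matching K-sym X-matching X⊆G) i j k edge₁ edge₂ =
    m-unique X-matching i j k (proj₁ (∧-true edge₁)) (proj₁ (∧-true edge₂))

  greedyUnion-matching : IsMatching G M → IsMatching G N → IsMatching G (greedyUnion M N)
  m-sym (greedyUnion-matching {M = M} M-matching N-matching) i j =
    cong₂ _∨_ (m-sym M-matching i j)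
              (cong₂ _∧_ (m-sym N-matching i j) (∧-comm (not (covered M i)) (not (covered M j))))
  m-sub (greedyUnion-matching {M = M} {N = N} M-matching N-matching) i j edge
    with greedyUnion-edge {M = M} {N = N} edge
  ... | inj₁ Mij       = m-sub M-matching i j Mij
  ... | inj₂ (Nij , _) = m-sub N-matching i j Nij
  m-unique (greedyUnion-matching {M = M} {N = N} M-matching N-matching) i j k edge₁ edge₂
    with greedyUnion-edge {M = M} {N = N} edge₁ | greedyUnion-edge {M = M} {N = N} edge₂
  ... | inj₁ Mij        | inj₁ Mik        = m-unique M-matching i j k Mij Mik
  ... | inj₁ Mij        | inj₂ (_ , Mi , _) with () ← trans (sym (covered-intro {E = M} Mij)) Mi
  ... | inj₂ (_ , Mi , _) | inj₁ Mik        with () ← trans (sym (covered-intro {E = M} Mik)) Mi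
  ... | inj₂ (Nij , _)  | inj₂ (Nik , _)  = m-unique N-matching i j k Nij Nik

  maximum-size-≡ : IsMaximumMatching G F → IsMaximumMatching G F' → size F ≡ size F'
  maximum-size-≡ (F-matching , F-max) (F'-matching , F'-max) =
    ≤-antisym (F'-max _ F-matching) (F-max _ F'-matching)

  size≤ν : IsNu G k → IsMatching G M → size M ≤ k
  size≤ν (_ , (_ , max) , refl) M-matching = max _ M-matching

  maximum-size≡ν : IsNu G k → IsMaximumMatching G M → size M ≡ k
  maximum-size≡ν (_ , N-maximum , refl) M-maximum = maximum-size-≡ M-maximum N-maximum

  size≡ν⇒maximum : IsNu G k → IsMatching G M → size M ≡ k → IsMaximumMatching G M
  size≡ν⇒maximum ν M-matching refl = M-matching , λ _ M'-matching → size≤ν ν M'-matching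

  size-∖ₑ-swap : IsMaximumMatching G F → IsMaximumMatching G F' →
                 size (F ∖ₑ F') ≡ size (F' ∖ₑ F)
  size-∖ₑ-swap {F = F} {F' = F'} F-maximum F'-maximum =
    +-cancelʳ-≡ (size (F ∩ₑ F')) _ _ (begin
      size (F ∖ₑ F') + size (F ∩ₑ F')  ≡⟨ size-split F F' ⟨
      size F                           ≡⟨ maximum-size-≡ F-maximum F'-maximum ⟩
      size F'                          ≡⟨ size-split F' F ⟩
      size (F' ∖ₑ F) + size (F' ∩ₑ F)  ≡⟨ cong (size (F' ∖ₑ F) +_) (size-∩ₑ-comm F' F) ⟩
      size (F' ∖ₑ F) + size (F ∩ₑ F')  ∎)
    where open ≡-Reasoning

  maximum-perfect : (∃ λ P → IsPerfectMatching G P) → IsMaximumMatching G F →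
                    IsPerfectMatching G F
  maximum-perfect {F = F} (P , P-matching , P-covers) (F-matching , F-max) =
    F-matching , covers
    where
    covers : ∀ i → ∃ λ j → F i j ≡ true
    covers i with any? (λ j → F i j ≟ᵇ true)
    ... | yes edge      = edge
    ... | no uncovered = contradiction (begin-strict
      ∑[ v < n ] 1                    ≤⟨ sum-mono-≤ (λ v → ≤-degree P (proj₂ (P-covers v))) ⟩
      ∑[ v < n ] degree P v           ≡⟨ sum-degree-matching P-matching ⟩
      2 * size P                      ≤⟨ *-monoʳ-≤ 2 (F-max P P-matching) ⟩
      2 * size F                      ≡⟨ sum-degree-matching F-matching ⟨
      ∑[ v < n ] degree F v           <⟨ sum-mono-< (degree-≤1 F-matching) i
                                           (≤-reflexive (cong suc (degree-uncovered F uncovered))) ⟩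
      ∑[ v < n ] 1                    ∎) (<-irrefl refl)
      where open ≤-Reasoning

module _ {G : Graph n} where
  open IsMatching

  ν∖-≤-2*ν∖ : ∀ {a a'} → IsMaximumMatching G F → IsMaximumMatching G F' →
              IsNu (G ∖ F) a → IsNu (G ∖ F') a' → a' ≤ 2 * a
  ν∖-≤-2*ν∖ {F = F} {F' = F'} {a} F-maximum F'-maximum νa (H , (H-matching , _) , refl) = begin
    size H
      ≤⟨ size-≤-∖ₑ+∖ₑ H F F' (matching-∖-disjoint {G = G} H-matching) ⟩
    size (H ∖ₑ F) + size (F ∖ₑ F')
      ≡⟨ cong (size (H ∖ₑ F) +_) (size-∖ₑ-swap F-maximum F'-maximum) ⟩
    size (H ∖ₑ F) + size (F' ∖ₑ F)
      ≤⟨ +-mono-≤ (size≤ν νa H∖F-matching) (size≤ν νa F'∖F-matching) ⟩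
    a + a
      ≡⟨ cong (a +_) (+-identityʳ a) ⟨
    2 * a ∎
    where
    open ≤-Reasoning
    F-sym = m-sym (proj₁ F-maximum)
    H∖F-matching : IsMatching (G ∖ F) (H ∖ₑ F)
    H∖F-matching = ∖ₑ-matching {G = G} F-sym H-matching (matching-∖-⊆ {G = G} H-matching)
    F'∖F-matching : IsMatching (G ∖ F) (F' ∖ₑ F)
    F'∖F-matching = ∖ₑ-matching {G = G} F-sym (proj₁ F'-maximum) (m-sub (proj₁ F'-maximum))

m≤o⇒n≤o⇒o+o≤m+n⇒m≡o×n≡o : ∀ {m n o} → m ≤ o → n ≤ o → o + o ≤ m + n → m ≡ o × n ≡ o
m≤o⇒n≤o⇒o+o≤m+n⇒m≡o×n≡o {m} {n} {o} m≤o n≤o o+o≤m+n =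
  ≤-antisym m≤o (+-cancelʳ-≤ n o m (≤-trans (+-monoʳ-≤ o n≤o) o+o≤m+n)) ,
  ≤-antisym n≤o (+-cancelˡ-≤ m o n (≤-trans (+-monoˡ-≤ o m≤o) o+o≤m+n))

module DoubleDeletion {G : Graph n} {Fl FL HL : EdgeSet n}
  (Fl-maximum : IsMaximumMatching G Fl) (FL-maximum : IsMaximumMatching G FL)
  (νl : IsNu (G ∖ Fl) l) (HL-maximum : IsMaximumMatching (G ∖ FL) HL)
  (|HL|≡2l : size HL ≡ 2 * l) where
  open IsMatching

  private
    Fl-matching = proj₁ Fl-maximum
    FL-matching = proj₁ FL-maximum
    HL-matching = proj₁ HL-maximum

  HL∖Fl-matching : IsMatching (G ∖ Fl) (HL ∖ₑ Fl)
  HL∖Fl-matching =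
    ∖ₑ-matching {G = G} (m-sym Fl-matching) HL-matching (matching-∖-⊆ {G = G} HL-matching)

  FL∖Fl-matching : IsMatching (G ∖ Fl) (FL ∖ₑ Fl)
  FL∖Fl-matching = ∖ₑ-matching {G = G} (m-sym Fl-matching) FL-matching (m-sub FL-matching)

  Fl∖FL-matching : IsMatching (G ∖ FL) (Fl ∖ₑ FL)
  Fl∖FL-matching = ∖ₑ-matching {G = G} (m-sym FL-matching) Fl-matching (m-sub Fl-matching)

  HL∩Fl⊆Fl∖FL : (HL ∩ₑ Fl) ⊆ₑ (Fl ∖ₑ FL)
  HL∩Fl⊆Fl∖FL i j edge with ∧-true {a = HL i j} edge
  ... | HLij , Flij rewrite Flij | matching-∖-disjoint {G = G} HL-matching i j HLij = refl

  |Fl∖FL|≤l : size (Fl ∖ₑ FL) ≤ l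
  |Fl∖FL|≤l = ≤-trans (≤-reflexive (size-∖ₑ-swap Fl-maximum FL-maximum)) (size≤ν νl FL∖Fl-matching)

  |HL∖Fl|≡l×|HL∩Fl|≡l : size (HL ∖ₑ Fl) ≡ l × size (HL ∩ₑ Fl) ≡ l
  |HL∖Fl|≡l×|HL∩Fl|≡l = m≤o⇒n≤o⇒o+o≤m+n⇒m≡o×n≡o
    (size≤ν νl HL∖Fl-matching)
    (≤-trans (size-mono HL∩Fl⊆Fl∖FL) |Fl∖FL|≤l)
    (≤-reflexive (begin
      l + l                              ≡⟨ cong (l +_) (+-identityʳ l) ⟨
      2 * l                              ≡⟨ |HL|≡2l ⟨
      size HL                            ≡⟨ size-split HL Fl ⟩
      size (HL ∖ₑ Fl) + size (HL ∩ₑ Fl)  ∎))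
    where open ≡-Reasoning

  |HL∖Fl|≡l : size (HL ∖ₑ Fl) ≡ l
  |HL∖Fl|≡l = proj₁ |HL∖Fl|≡l×|HL∩Fl|≡l

  |HL∩Fl|≡l : size (HL ∩ₑ Fl) ≡ l
  |HL∩Fl|≡l = proj₂ |HL∖Fl|≡l×|HL∩Fl|≡l

  Fl∖FL⊆HL∩Fl : (Fl ∖ₑ FL) ⊆ₑ (HL ∩ₑ Fl)
  Fl∖FL⊆HL∩Fl = upper⊇⇒⊇
    (λ i j → cong₂ _∧_ (m-sym HL-matching i j) (m-sym Fl-matching i j))
    (m-sym Fl∖FL-matching) (matching-irreflexive Fl∖FL-matching)
    (⊆-size-≥⇒upper⊇ HL∩Fl⊆Fl∖FL (≤-trans |Fl∖FL|≤l (≤-reflexive (sym |HL∩Fl|≡l))))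

  Fl∖FL⊆HL : (Fl ∖ₑ FL) ⊆ₑ HL
  Fl∖FL⊆HL i j edge = proj₁ (∧-true (Fl∖FL⊆HL∩Fl i j edge))

  HL∖Fl-maximum : IsMaximumMatching (G ∖ Fl) (HL ∖ₑ Fl)
  HL∖Fl-maximum = size≡ν⇒maximum νl HL∖Fl-matching |HL∖Fl|≡l

  FL∖Fl-maximum : IsMaximumMatching (G ∖ Fl) (FL ∖ₑ Fl)
  FL∖Fl-maximum = size≡ν⇒maximum νl FL∖Fl-matching (≤-antisym (size≤ν νl FL∖Fl-matching) (begin
    l                  ≡⟨ |HL∩Fl|≡l ⟨
    size (HL ∩ₑ Fl)    ≤⟨ size-mono HL∩Fl⊆Fl∖FL ⟩
    size (Fl ∖ₑ FL)    ≡⟨ size-∖ₑ-swap Fl-maximum FL-maximum ⟩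
    size (FL ∖ₑ Fl)    ∎))
    where open ≤-Reasoning

module _ {G : Graph n} where
  open IsMatching

  sum-ind*weight≤sum : IsMatching G H → (t : Fin n → ℕ) →
                       ∑[ u < n ] ∑[ v < n ] (ind (H u v) * t u) ≤ sum t
  sum-ind*weight≤sum {H = H} H-matching t = sum-mono-≤ λ u → begin
    ∑[ v < n ] (ind (H u v) * t u)  ≡⟨ *-distribʳ-sum (t u) (ind ∘ H u) ⟨
    degree H u * t u               ≤⟨ *-monoˡ-≤ (t u) (degree-≤1 H-matching u) ⟩
    t u + 0                        ≡⟨ +-identityʳ (t u) ⟩
    t u                            ∎
    where open ≤-Reasoning

  sum-endpoint-weights≤2*sum : IsMatching G H → (t : Fin n → ℕ) →
    ∑[ u < n ] ∑[ v < n ] (ind (H u v) * t u + ind (H u v) * t v) ≤ 2 * sum t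
  sum-endpoint-weights≤2*sum {H = H} H-matching t = begin
    ∑[ u < n ] ∑[ v < n ] (ind (H u v) * t u + ind (H u v) * t v)
      ≡⟨ sum-cong-≗ (λ u → ∑-distrib-+ (λ v → ind (H u v) * t u) (λ v → ind (H u v) * t v)) ⟩
    ∑[ u < n ] (∑[ v < n ] (ind (H u v) * t u) + ∑[ v < n ] (ind (H u v) * t v))
      ≡⟨ ∑-distrib-+ (λ u → ∑[ v < n ] (ind (H u v) * t u)) (λ u → ∑[ v < n ] (ind (H u v) * t v)) ⟩
    S + ∑[ u < n ] ∑[ v < n ] (ind (H u v) * t v)
      ≡⟨ cong (S +_) (∑-comm (λ u v → ind (H u v) * t v)) ⟩
    S + ∑[ v < n ] ∑[ u < n ] (ind (H u v) * t v)
      ≡⟨ cong (S +_) (sum-cong-≗ λ v → sum-cong-≗ λ u → cong (λ b → ind b * t v) (m-sym H-matching u v)) ⟩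
    S + ∑[ v < n ] ∑[ u < n ] (ind (H v u) * t v)
      ≤⟨ +-mono-≤ (sum-ind*weight≤sum H-matching t) (sum-ind*weight≤sum H-matching t) ⟩
    sum t + sum t
      ≡⟨ cong (sum t +_) (+-identityʳ (sum t)) ⟨
    2 * sum t ∎
    where
    open ≤-Reasoning
    S = ∑[ u < n ] ∑[ v < n ] (ind (H u v) * t u)

  matching-weight : IsMatching G H → (t : Fin n → ℕ) →
                    (∀ u v → H u v ≡ true → k ≤ t u + t v) → size H * k ≤ sum t
  matching-weight {H = H} {k = k} H-matching t edge-weight = *-cancelˡ-≤ 2 (begin
    2 * (size H * k)
      ≡⟨ *-assoc 2 (size H) k ⟨
    2 * size H * k
      ≡⟨ cong (_* k) (sum-degree-matching H-matching) ⟨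
    ∑[ u < n ] degree H u * k
      ≡⟨ *-distribʳ-sum k (degree H) ⟩
    ∑[ u < n ] (degree H u * k)
      ≡⟨ sum-cong-≗ (λ u → *-distribʳ-sum k (ind ∘ H u)) ⟩
    ∑[ u < n ] ∑[ v < n ] (ind (H u v) * k)
      ≤⟨ sum-mono-≤ (λ u → sum-mono-≤ (pointwise u)) ⟩
    ∑[ u < n ] ∑[ v < n ] (ind (H u v) * t u + ind (H u v) * t v)
      ≤⟨ sum-endpoint-weights≤2*sum H-matching t ⟩
    2 * sum t ∎)
    where
    open ≤-Reasoning
    pointwise : ∀ u v → ind (H u v) * k ≤ ind (H u v) * t u + ind (H u v) * t v
    pointwise u v with H u v in Huv
    ... | false = z≤n
    ... | true  = subst₂ _≤_ (sym (*-identityˡ k))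
                    (sym (cong₂ _+_ (*-identityˡ (t u)) (*-identityˡ (t v))))
                    (edge-weight u v Huv)

module PerfectDeletion {G : Graph n} {F P H : EdgeSet n}
  (F-matching : IsMatching G F) (νl : IsNu (G ∖ F) l)
  (P-perfect : IsPerfectMatching G P) (H-matching : IsMatching (G ∖ P) H) where
  open IsMatching

  B C D : EdgeSet n
  B = H ∖ₑ F
  C = P ∖ₑ F
  D = greedyUnion C B

  B-matching : IsMatching (G ∖ F) B
  B-matching =
    ∖ₑ-matching {G = G} (m-sym F-matching) H-matching (matching-∖-⊆ {G = G} H-matching)

  C-matching : IsMatching (G ∖ F) C
  C-matching =
    ∖ₑ-matching {G = G} (m-sym F-matching) (proj₁ P-perfect) (m-sub (proj₁ P-perfect))

  D-matching : IsMatching (G ∖ F) D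
  D-matching = greedyUnion-matching C-matching B-matching

  C⊆D : C ⊆ₑ D
  C⊆D u w = greedyUnion-⊇ˡ {M = C} {i = u} {j = w} {N = B}

  weight : Fin n → ℕ
  weight u = degree B u + degree C u + degree D u

  -- P covers u by an edge uw, and uw ∉ F: otherwise w = v, yet uv ∈ H lies outside P.
  H∩F-C-covered : H u v ≡ true → F u v ≡ true → ∃ λ w → C u w ≡ true
  H∩F-C-covered {u = u} {v = v} Huv Fuv with proj₂ P-perfect u
  ... | w , Puw with F u w in Fuw
  ...   | false = w , cong₂ _∧_ Puw (cong not Fuw)
  ...   | true with m-unique F-matching u v w Fuv Fuw
  ...     | refl with () ← trans (sym Puw) (matching-∖-disjoint {G = G} H-matching u v Huv)

  C-edge-weight : C u w ≡ true → 2 ≤ weight u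
  C-edge-weight {u = u} Cuw =
    +-mono-≤ (+-mono-≤ (z≤n {degree B u}) (≤-degree C Cuw)) (≤-degree D (C⊆D _ _ Cuw))

  B-edge-weight : B u v ≡ true → 1 ≤ weight u
  B-edge-weight {u = u} Buv =
    +-mono-≤ (+-mono-≤ (≤-degree B Buv) (z≤n {degree C u})) (z≤n {degree D u})

  B-C-edge-weight : B u v ≡ true → C u w ≡ true → 3 ≤ weight u
  B-C-edge-weight Buv Cuw =
    +-mono-≤ (+-mono-≤ (≤-degree B Buv) (≤-degree C Cuw)) (≤-degree D (C⊆D _ _ Cuw))

  B-D-edge-weight : B u v ≡ true → D u v ≡ true → 2 ≤ weight u
  B-D-edge-weight {u = u} Buv Duv =
    +-mono-≤ (+-mono-≤ (≤-degree B Buv) (z≤n {degree C u})) (≤-degree D Duv)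

  B-weight : B u v ≡ true → 4 ≤ weight u + weight v
  B-weight {u = u} {v = v} Buv = by-coverage (covered C u) (covered C v) refl refl
    where
    Bvu : B v u ≡ true
    Bvu = trans (m-sym B-matching v u) Buv
    B⊆D : ∀ {u v} → B u v ≡ true → covered C u ≡ false → covered C v ≡ false → D u v ≡ true
    B⊆D = greedyUnion-⊇ʳ {N = B} {M = C}
    -- not a with: covered C u also occurs in weight u, through D
    by-coverage : ∀ cu cv → covered C u ≡ cu → covered C v ≡ cv → 4 ≤ weight u + weight v
    by-coverage true  _     Cu _  =
      +-mono-≤ (B-C-edge-weight Buv (proj₂ (covered-elim {E = C} Cu))) (B-edge-weight Bvu)
    by-coverage false true  _  Cv =
      +-mono-≤ (B-edge-weight Buv) (B-C-edge-weight Bvu (proj₂ (covered-elim {E = C} Cv)))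
    by-coverage false false Cu Cv =
      +-mono-≤ (B-D-edge-weight Buv (B⊆D Buv Cu Cv)) (B-D-edge-weight Bvu (B⊆D Bvu Cv Cu))

  H-weight : ∀ u v → H u v ≡ true → 4 ≤ weight u + weight v
  H-weight u v Huv with F u v in Fuv
  ... | true  = +-mono-≤ (C-edge-weight (proj₂ (H∩F-C-covered Huv Fuv)))
                         (C-edge-weight (proj₂ (H∩F-C-covered Hvu Fvu)))
    where
    Hvu = trans (m-sym H-matching v u) Huv
    Fvu = trans (m-sym F-matching v u) Fuv
  ... | false = B-weight (cong₂ _∧_ Huv (cong not Fuv))

  sum-weight : sum weight ≤ 2 * l + 2 * l + 2 * l
  sum-weight = begin
    sum weight
      ≡⟨ ∑-distrib-+ (λ u → degree B u + degree C u) (degree D) ⟩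
    sum (λ u → degree B u + degree C u) + sum (degree D)
      ≡⟨ cong (_+ sum (degree D)) (∑-distrib-+ (degree B) (degree C)) ⟩
    sum (degree B) + sum (degree C) + sum (degree D)
      ≡⟨ cong₂ _+_ (cong₂ _+_ (sum-degree-matching B-matching) (sum-degree-matching C-matching))
                   (sum-degree-matching D-matching) ⟩
    2 * size B + 2 * size C + 2 * size D
      ≤⟨ +-mono-≤ (+-mono-≤ (2*≤ν B-matching) (2*≤ν C-matching)) (2*≤ν D-matching) ⟩
    2 * l + 2 * l + 2 * l ∎
    where
    open ≤-Reasoning
    2*≤ν : ∀ {M} → IsMatching (G ∖ F) M → 2 * size M ≤ 2 * l
    2*≤ν M-matching = *-monoʳ-≤ 2 (size≤ν νl M-matching)

  2*|H|≤3*l : 2 * size H ≤ 3 * l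
  2*|H|≤3*l = *-cancelʳ-≤ (2 * size H) (3 * l) 2 (begin
    2 * size H * 2         ≡⟨ 2m*2≡m*4 (size H) ⟩
    size H * 4             ≤⟨ matching-weight H-matching weight H-weight ⟩
    sum weight             ≤⟨ sum-weight ⟩
    2 * l + 2 * l + 2 * l  ≡⟨ 2m+2m+2m≡3m*2 l ⟩
    3 * l * 2              ∎)
    where
    open ≤-Reasoning
    2m*2≡m*4 : ∀ m → 2 * m * 2 ≡ m * 4
    2m*2≡m*4 = solve-∀
    2m+2m+2m≡3m*2 : ∀ m → 2 * m + 2 * m + 2 * m ≡ 3 * m * 2
    2m+2m+2m≡3m*2 = solve-∀

theorem2 : ∀ {n} (G : Graph n) →
    (∀ F F' a a' → IsMaximumMatching G F → IsMaximumMatching G F' →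
       IsNu (G ∖ F) a → IsNu (G ∖ F') a' → a' ≤ 2 * a)
    × (∀ L l → IsL G L → Isl G l → L ≤ 2 * l)
    × (∀ L l FL Fl HL → IsL G L → Isl G l → L ≡ 2 * l →
         IsMaximumMatching G FL → IsNu (G ∖ FL) L →
         IsMaximumMatching G Fl → IsNu (G ∖ Fl) l →
         IsMaximumMatching (G ∖ FL) HL →
         ((Fl ∖ₑ FL) ⊆ₑ HL)
         × IsMaximumMatching (G ∖ Fl) (HL ∖ₑ Fl)
         × IsMaximumMatching (G ∖ Fl) (FL ∖ₑ Fl))
    × ((∃ λ M → IsPerfectMatching G M) →
         ∀ L l → IsL G L → Isl G l → 2 * L ≤ 3 * l)
theorem2 G =
    (λ _ _ _ _ → ν∖-≤-2*ν∖)
  , (λ { _ _ ((_ , FL-maximum , νL) , _) ((_ , Fl-maximum , νl) , _) →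
         ν∖-≤-2*ν∖ Fl-maximum FL-maximum νl νL })
  , (λ { _ _ _ _ _ _ _ refl FL-maximum νL Fl-maximum νl HL-maximum →
         let open DoubleDeletion Fl-maximum FL-maximum νl HL-maximum
                                 (maximum-size≡ν νL HL-maximum)
         in Fl∖FL⊆HL , HL∖Fl-maximum , FL∖Fl-maximum })
  , λ { perfect _ _ ((_ , FL-maximum , (HL , (HL-matching , _) , refl)) , _)
                    ((_ , (Fl-matching , _) , νl) , _) →
        PerfectDeletion.2*|H|≤3*l Fl-matching νl (maximum-perfect perfect FL-maximum) HL-matching }
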